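{- Every two-terminal circuit game is immune to the informational Braess' paradox (IBP). That is, let $G$ be an undirected network with a single origin–destination pair $(O,D)$ whose relevant network (the union of the edges lying on some simple $O$–$D$ path) forms a single cycle. Then for every choice of continuous, non-decreasing, non-negative edge cost functions, every choice of information types with demands $d_{k}\ge 0$ and information sets $E_{k}$, and every expansion $E_{1}\subset \tilde E_{1}$ of the information set of one type (all other information sets unchanged), if $\bm{x}$ and $\tilde{\bm{x}}$ are information constrained user equilibria before and after the expansion respectively, then $C_{1}(\tilde{\bm{x}}) \le C_{1}(\bm{x})$.
   Context: A nonatomic network congestion game is played on an undirected network $G=(V,E)$ with edge cost functions $c_e:\mathbb{R}_{\ge 0}\to\mathbb{R}_{\ge 0}\cup\{\infty\}$ that are continuous, non-decreasing and non-negative. There is a finite set $N$ of populations; population $i$ travels from origin $O_i$ to destination $D_i$ (distinct populations have distinct origin–destination pairs). The relevant edge set $E_i$ of population $i$ consists of the edges lying on at least one simple $O_i$–$D_i$ path, and $G_i=(V_i,E_i)$ is its relevant network. Population $i$ is divided into information types $k\in K_i$, each with demand $d_{ik}\ge 0$ and information set $E_{ik}\subseteq E_i$; the strategy set $S_{ik}$ of type $(i,k)$ consists of the simple $O_i$–$D_i$ paths using only edges of $E_{ik}$ (assumed nonempty). An outcome $\bm{x}$ assigns flows $x^{ik}_s\ge 0$ to $s\in S_{ik}$ with $\sum_{s\in S_{ik}}x^{ik}_s=d_{ik}$. The load of edge $e$ is $f_e(\bm{x})=\sum_{i,k}\sum_{s\in S_{ik},\,e\in s}x^{ik}_s$, and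 the cost of a path $s$ is $C(s,\bm{x})=\sum_{e\in s}c_e(f_e(\bm{x}))$. An information constrained user equilibrium (ICUE) is an outcome $\bm{x}$ such that for every type $(i,k)$ and all $s,s'\in S_{ik}$ with $x^{ik}_s>0$, $C(s,\bm{x})\le C(s',\bm{x})$. The equilibrium cost of type $(i,k)$ is $C_{ik}(\bm{x})=\min_{s\in S_{ik}}C(s,\bm{x})$ (the common cost of its used paths). IBP occurs if, for expanded information sets $\tilde E_{ik}$ with $E_{11}\subset\tilde E_{11}$ and $\tilde E_{ik}=E_{ik}$ for $(i,k)\ne(1,1)$, there are ICUE $\bm{x}$ (for the original sets) and $\tilde{\bm{x}}$ (for the expanded sets) with $C_{11}(\bm{x})<C_{11}(\tilde{\bm{x}})$; a network is immune to IBP if this never occurs for any costs, demands and information sets. A game is two-terminal if there is a single origin–destination pair (one population). A circuit game is one in which every population's relevant network $G_i$ is a circuit, i.e., its edges form a single cycle. -}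

module Defs where

open import Level using (0ℓ)
open import Data.Nat using (ℕ; suc)
open import Data.Fin using (Fin; zero)
open import Data.Fin.Properties using (_≟_)
open import Data.Fin.Subset using (Subset; _∈_)
open import Data.Bool using (Bool; true; false; if_then_else_)
open import Data.Product using (Σ; ∃; ∃-syntax; _×_; _,_; proj₁; proj₂)
open import Data.Sum using (_⊎_)
open import Data.Unit using (⊤)
open import Data.Empty using (⊥)
open import Data.List using (List; []; _∷_; foldr; map; allFin)
open import Data.List.Relation.Unary.All using (All)
open import Data.List.Relation.Unary.Unique.Propositional using (Unique)
open import Data.List.Membership.Propositional using () renaming (_∈_ to _∈ₗ_)
open import Relation.Nullary using (¬_; does)
open import Relation.Binary.PropositionalEquality using (_≡_; _≢_)
open import Algebra.Structures using (IsCommutativeRing)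
open import Relation.Binary.Structures using (IsTotalOrder)

record RealNumbers : Set₁ where
  infixl 6 _+_
  infixl 7 _*_
  infix 4 _≤_
  field
    R      : Set
    _+_    : R → R → R
    _*_    : R → R → R
    -_     : R → R
    0#     : R
    1#     : R
    _≤_    : R → R → Set
    isCommutativeRing : IsCommutativeRing _≡_ _+_ _*_ -_ 0# 1#
    0≢1    : 0# ≢ 1#
    inverse : ∀ x → x ≢ 0# → ∃[ y ] (x * y ≡ 1#)
    isTotalOrder : IsTotalOrder _≡_ _≤_
    +-mono-≤ : ∀ {x y} z → x ≤ y → x + z ≤ y + z
    *-nonneg : ∀ {x y} → 0# ≤ x → 0# ≤ y → 0# ≤ x * y
    lub : (P : R → Set) → ∃ P → (∃[ b ] (∀ x → P x → x ≤ b)) →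
          ∃[ s ] ((∀ x → P x → x ≤ s) × (∀ b → (∀ x → P x → x ≤ b) → s ≤ b))

module Reals (ℝ : RealNumbers) where
  open RealNumbers ℝ public

  infix 4 _<_
  _<_ : R → R → Set
  x < y = x ≤ y × x ≢ y

  _-_ : R → R → R
  x - y = x + (- y)

  AbsLt : R → R → Set
  AbsLt x ε = (x < ε) × ((- ε) < x)

  data R∞ : Set where
    fin : R → R∞
    ∞   : R∞

  infixl 6 _+∞_
  _+∞_ : R∞ → R∞ → R∞
  fin a +∞ fin b = fin (a + b)
  fin _ +∞ ∞     = ∞
  ∞     +∞ _     = ∞

  infix 4 _≤∞_
  _≤∞_ : R∞ → R∞ → Set
  fin a ≤∞ fin b = a ≤ b
  _     ≤∞ ∞     = ⊤
  ∞     ≤∞ fin _ = ⊥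

  Above : R → R∞ → Set
  Above M (fin w) = M < w
  Above M ∞       = ⊤

  -- continuity at a ≥ 0 of c : [0,∞) → [0,∞] (order topology on [0,∞])
  ContinuousAt : (R → R∞) → R → R∞ → Set
  ContinuousAt c a (fin v) =
    ∀ ε → 0# < ε → ∃[ δ ] (0# < δ × (∀ y → 0# ≤ y → AbsLt (y - a) δ →
      ∃[ w ] (c y ≡ fin w × AbsLt (w - v) ε)))
  ContinuousAt c a ∞ =
    ∀ M → ∃[ δ ] (0# < δ × (∀ y → 0# ≤ y → AbsLt (y - a) δ → Above M (c y)))

  AdmissibleCost : (R → R∞) → Set
  AdmissibleCost c =
    (∀ y → 0# ≤ y → fin 0# ≤∞ c y) ×
    (∀ y z → 0# ≤ y → y ≤ z → c y ≤∞ c z) ×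
    (∀ a → 0# ≤ a → ContinuousAt c a (c a))

  sumR : List R → R
  sumR = foldr _+_ 0#

  module Network {n m : ℕ} (ends : Fin m → Fin n × Fin n) (O D : Fin n) where

    Joins : Fin m → Fin n → Fin n → Set
    Joins e u w = (ends e ≡ (u , w)) ⊎ (ends e ≡ (w , u))

    data Trail : Fin n → Fin n → List (Fin m) → List (Fin n) → Set where
      nil  : ∀ {v} → Trail v v [] (v ∷ [])
      cons : ∀ {e u w t es vs} → Joins e u w → Trail w t es vs →
             Trail u t (e ∷ es) (u ∷ vs)

    SimplePath : List (Fin m) → Set
    SimplePath es = ∃[ vs ] (Trail O D es vs × Unique vs)

    Relevant : Fin m → Set
    Relevant e = ∃[ es ] (SimplePath es × e ∈ₗ es)

    IsCircuit : Set
    IsCircuit = ∃[ cyc ] ∃[ v ] ∃[ vs ]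
      ( cyc ≢ [] × Trail v v cyc (v ∷ vs) × Unique vs × Unique cyc ×
        (∀ e → Relevant e → e ∈ₗ cyc) × (∀ e → e ∈ₗ cyc → Relevant e) )

    -- Information types k : Fin (suc t); type zero is "type 1".

    module Game (t : ℕ) (c : Fin m → R → R∞) (d : Fin (suc t) → R) where

      InfoSets : Set
      InfoSets = Fin (suc t) → Subset m

      Strategy : InfoSets → Fin (suc t) → List (Fin m) → Set
      Strategy E k s = SimplePath s × All (λ e → e ∈ E k) s

      -- an outcome: for every type a finite list of (path, flow) pairs
      -- (a path-flow assignment; repeated paths add up)
      Outcome : Set
      Outcome = Fin (suc t) → List (List (Fin m) × R)

      occurs : Fin m → List (Fin m) → Bool
      occurs e []       = false
      occurs e (e' ∷ s) = if does (e ≟ e') then true else occurs e s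

      load : Outcome → Fin m → R
      load x e = sumR (map (λ k → sumR (map (λ p → if occurs e (proj₁ p) then proj₂ p else 0#) (x k)))
                           (allFin (suc t)))

      pathCost : Outcome → List (Fin m) → R∞
      pathCost x s = foldr (λ e acc → c e (load x e) +∞ acc) (fin 0#) s

      Feasible : InfoSets → Outcome → Set
      Feasible E x = ∀ k →
        All (λ p → Strategy E k (proj₁ p) × 0# ≤ proj₂ p) (x k) ×
        (sumR (map proj₂ (x k)) ≡ d k)

      ICUE : InfoSets → Outcome → Set
      ICUE E x = Feasible E x ×
        (∀ k s a → (s , a) ∈ₗ x k → 0# < a →
          ∀ s' → Strategy E k s' → pathCost x s ≤∞ pathCost x s')

      IsEqCost : InfoSets → Fin (suc t) → Outcome → R∞ → Set
      IsEqCost E k x κ =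
        (∃[ s ] (Strategy E k s × pathCost x s ≡ κ)) ×
        (∀ s → Strategy E k s → κ ≤∞ pathCost x s)

      expand : InfoSets → Subset m → InfoSets
      expand E Ẽ₁ zero    = Ẽ₁
      expand E Ẽ₁ (Fin.suc k) = E (Fin.suc k)

-- The relevant network is a cycle, so there are at most two simple O–D routes: the route P
-- that type 1 uses before the expansion and a route Q through a newly revealed edge.
-- Every edge of P shared with Q carries the whole demand, every other edge of P carries the
-- total flow on P.  Hence if the flow on P does not grow, no edge of P gets more load and
-- C(P) does not grow.  If it grows, the flow on Q shrinks, so C(Q) does not grow, and some
-- other type must have moved from Q to P; its equilibrium conditions before and after give
-- C(P, x̃) ≤ C(Q, x̃) ≤ C(Q, x) ≤ C(P, x).  Either way C̃₁ ≤ C(P, x̃) ≤ C(P, x) = C₁.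
-- Positivity of flows is not decidable, so both case splits are made under a double
-- negation; the order on a complete ordered field is ¬¬-stable by an Archimedean argument.
module Submission where

open import Defs
open import Data.Nat using (ℕ; zero; suc)
open import Data.Fin using (Fin; zero; suc)
open import Data.Fin.Properties using (_≟_)
open import Data.Fin.Subset using (Subset; _∈_; _⊂_)
open import Data.Bool using (Bool; true; false; if_then_else_)
open import Data.Product using (Σ; ∃-syntax; _×_; _,_; proj₁; proj₂)
open import Data.Sum using (_⊎_; inj₁; inj₂)
import Data.Sum as Sum
open import Data.Unit using (tt)
open import Data.Empty using (⊥; ⊥-elim)
open import Data.List using (List; []; _∷_; map; allFin)
open import Data.List.Properties using (≡-dec)
open import Data.List.Relation.Unary.All using (All; []; _∷_; tabulate)
import Data.List.Relation.Unary.All as All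
open import Data.List.Relation.Unary.All.Properties using (All¬⇒¬Any)
open import Data.List.Relation.Unary.Any using (here; there)
open import Data.List.Relation.Unary.AllPairs using (_∷_)
open import Data.List.Relation.Unary.Unique.Propositional using (Unique)
open import Data.List.Membership.Propositional using () renaming (_∈_ to _∈ₗ_; _∉_ to _∉ₗ_)
open import Function using (_∘_; case_of_)
open import Relation.Nullary using (¬_; does; yes; no)
open import Relation.Nullary.Decidable using (dec-true; dec-false)
open import Relation.Nullary.Decidable.Core using (¬¬-excluded-middle)
open import Relation.Binary.PropositionalEquality
open import Relation.Binary.Bundles using (Poset)
open import Relation.Binary.Structures using (IsTotalOrder)
import Relation.Binary.Reasoning.PartialOrder as PartialOrderReasoning
open import Algebra.Structures using (IsCommutativeRing)
open import Algebra.Bundles using (CommutativeRing; Ring)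
import Algebra.Properties.CommutativeSemigroup as CommutativeSemigroupProperties
import Algebra.Properties.Group as GroupProperties
import Algebra.Properties.Ring as RingProperties

module OrderedFieldProperties (ℝ : RealNumbers) where
  open Reals ℝ
  open IsCommutativeRing isCommutativeRing using (+-comm; +-identityˡ; +-identityʳ; -‿inverseʳ)
  open IsTotalOrder isTotalOrder public
    using (total; antisym) renaming (refl to ≤-refl; trans to ≤-trans; reflexive to ≤-reflexive)

  commutativeRing : CommutativeRing _ _
  commutativeRing = record { isCommutativeRing = isCommutativeRing }

  private
    ring : Ring _ _
    ring = CommutativeRing.ring commutativeRing
  open RingProperties ring using (-1*x≈-x; -‿involutive)
  open GroupProperties (Ring.+-group ring) using (//-rightDividesˡ; //-rightDividesʳ)

  ≤-poset : Poset _ _ _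
  ≤-poset = record { isPartialOrder = IsTotalOrder.isPartialOrder isTotalOrder }

  module ≤-Reasoning = PartialOrderReasoning ≤-poset

  +-monoʳ-≤ : ∀ {x y} z → x ≤ y → z + x ≤ z + y
  +-monoʳ-≤ {x} {y} z x≤y = subst₂ _≤_ (+-comm x z) (+-comm y z) (+-mono-≤ z x≤y)

  +-mono₂-≤ : ∀ {a b c d} → a ≤ b → c ≤ d → a + c ≤ b + d
  +-mono₂-≤ {b = b} {c} a≤b c≤d = ≤-trans (+-mono-≤ c a≤b) (+-monoʳ-≤ b c≤d)

  +-nonneg : ∀ {a b} → 0# ≤ a → 0# ≤ b → 0# ≤ a + b
  +-nonneg {a} {b} 0≤a 0≤b = subst (_≤ a + b) (+-identityʳ 0#) (+-mono₂-≤ 0≤a 0≤b)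

  +-cancelʳ-≤ : ∀ {a b} z → a + z ≤ b + z → a ≤ b
  +-cancelʳ-≤ {a} {b} z le = subst₂ _≤_ (//-rightDividesʳ z a) (//-rightDividesʳ z b) (+-mono-≤ (- z) le)

  ≤-complement : ∀ {a a' b b' s} → a ≤ a' → a + b ≡ s → a' + b' ≡ s → b' ≤ b
  ≤-complement {a} {a'} {b} {b'} a≤a' a+b≡s a'+b'≡s = +-cancelʳ-≤ a (subst (b' + a ≤_) b'+a'≡b+a (+-monoʳ-≤ b' a≤a'))
    where
    b'+a'≡b+a : b' + a' ≡ b + a
    b'+a'≡b+a = trans (+-comm b' a') (trans a'+b'≡s (trans (sym a+b≡s) (+-comm a b)))

  1≰0 : ¬ (1# ≤ 0#)
  1≰0 1≤0 = 0≢1 (sym (antisym 1≤0 0≤1))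
    where
    0≤-1 : 0# ≤ - 1#
    0≤-1 = subst₂ _≤_ (-‿inverseʳ 1#) (+-identityˡ (- 1#)) (+-mono-≤ (- 1#) 1≤0)
    0≤1 : 0# ≤ 1#
    0≤1 = subst (0# ≤_) (trans (-1*x≈-x (- 1#)) (-‿involutive 1#)) (*-nonneg 0≤-1 0≤-1)

  _×ℕ_ : ℕ → R → R
  zero  ×ℕ x = 0#
  suc k ×ℕ x = x + k ×ℕ x

  ×ℕ-zero : ∀ k → k ×ℕ 0# ≡ 0#
  ×ℕ-zero zero    = refl
  ×ℕ-zero (suc k) = trans (cong (0# +_) (×ℕ-zero k)) (+-identityʳ 0#)

  -- Archimedean argument: under ¬¬ (x ≡ 0) the multiples of x are bounded by 1,
  -- and their supremum s satisfies s + x ≤ s.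
  ¬¬≡0⇒≤0 : ∀ {x} → ¬ ¬ (x ≡ 0#) → x ≤ 0#
  ¬¬≡0⇒≤0 {x} ¬¬x≡0 = x≤0 (lub Multiple (0# , 0 , refl) (1# , multiple≤1))
    where
    Multiple : R → Set
    Multiple z = Σ ℕ λ k → z ≡ k ×ℕ x

    multiple≤1 : ∀ z → Multiple z → z ≤ 1#
    multiple≤1 z (k , refl) with total (k ×ℕ x) 1#
    ... | inj₁ kx≤1 = kx≤1
    ... | inj₂ 1≤kx = ⊥-elim (¬¬x≡0 λ x≡0 → 1≰0 (subst (1# ≤_) (trans (cong (k ×ℕ_) x≡0) (×ℕ-zero k)) 1≤kx))

    x≤0 : ∃[ s ] ((∀ z → Multiple z → z ≤ s) × (∀ b → (∀ z → Multiple z → z ≤ b) → s ≤ b)) → x ≤ 0#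
    x≤0 (s , s-upper , s-least) = +-cancelʳ-≤ s (subst₂ _≤_ (+-comm s x) (sym (+-identityˡ s)) s+x≤s)
      where
      s-x-upper : ∀ z → Multiple z → z ≤ s - x
      s-x-upper z (k , refl) =
        subst (_≤ s - x) (trans (cong (_- x) (+-comm x (k ×ℕ x))) (//-rightDividesʳ x (k ×ℕ x)))
          (+-mono-≤ (- x) (s-upper _ (suc k , refl)))

      s+x≤s : s + x ≤ s
      s+x≤s = subst (s + x ≤_) (//-rightDividesˡ x s) (+-mono-≤ x (s-least (s - x) s-x-upper))

  ≤-stable : ∀ {a b} → ¬ ¬ (a ≤ b) → a ≤ b
  ≤-stable {a} {b} ¬¬a≤b with total a b
  ... | inj₁ a≤b = a≤b
  ... | inj₂ b≤a = +-cancelʳ-≤ (- b) (subst (a - b ≤_) (sym (-‿inverseʳ b)) (¬¬≡0⇒≤0 ¬¬a-b≡0))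
    where
    ¬¬a-b≡0 : ¬ ¬ (a - b ≡ 0#)
    ¬¬a-b≡0 a-b≢0 = ¬¬a≤b λ a≤b → a-b≢0 (trans (cong (_- b) (antisym a≤b b≤a)) (-‿inverseʳ b))

  ¬positive⇒≤0 : ∀ {b} → 0# ≤ b → ¬ (0# < b) → b ≤ 0#
  ¬positive⇒≤0 0≤b ¬0<b = ≤-stable λ b≰0 → ¬0<b (0≤b , λ 0≡b → b≰0 (≤-reflexive (sym 0≡b)))

  ≤∞-trans : ∀ {a b c} → a ≤∞ b → b ≤∞ c → a ≤∞ c
  ≤∞-trans {fin a} {fin b} {fin c} a≤b b≤c = ≤-trans a≤b b≤c
  ≤∞-trans {fin a} {_}     {∞}     _   _   = tt
  ≤∞-trans {∞}     {∞}     {∞}     _   _   = tt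
  ≤∞-trans {fin a} {∞}     {fin c} _   ()
  ≤∞-trans {∞}     {∞}     {fin c} _   ()

  ≤∞-stable : ∀ {a b} → ¬ ¬ (a ≤∞ b) → a ≤∞ b
  ≤∞-stable {fin a} {fin b} ¬¬a≤b = ≤-stable ¬¬a≤b
  ≤∞-stable {fin a} {∞}     _     = tt
  ≤∞-stable {∞}     {∞}     _     = tt
  ≤∞-stable {∞}     {fin b} ¬¬∞≤b = ⊥-elim (¬¬∞≤b λ ())

  +∞-mono-≤∞ : ∀ {a b a' b'} → a ≤∞ b → a' ≤∞ b' → a +∞ a' ≤∞ b +∞ b'
  +∞-mono-≤∞ {fin a} {fin b} {fin a'} {fin b'} a≤b a'≤b' = +-mono₂-≤ a≤b a'≤b'
  +∞-mono-≤∞ {fin a} {fin b} {fin a'} {∞}     _   _     = tt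
  +∞-mono-≤∞ {fin a} {fin b} {∞}      {∞}     _   _     = tt
  +∞-mono-≤∞ {fin a} {∞}     {fin a'} {_}     _   _     = tt
  +∞-mono-≤∞ {fin a} {∞}     {∞}      {_}     _   _     = tt
  +∞-mono-≤∞ {∞}     {∞}     {fin a'} {_}     _   _     = tt
  +∞-mono-≤∞ {∞}     {∞}     {∞}      {_}     _   _     = tt
  +∞-mono-≤∞ {fin a} {fin b} {∞}      {fin b'} _  ()

module ListSums (ℝ : RealNumbers) where
  open Reals ℝ
  open OrderedFieldProperties ℝ
  open IsCommutativeRing isCommutativeRing using (+-identityʳ)
  open CommutativeSemigroupProperties (CommutativeRing.+-commutativeSemigroup commutativeRing)
    using () renaming (interchange to +-interchange)

  module _ {A : Set} where

    sumR-mono : (f g : A → R) (xs : List A) → All (λ i → f i ≤ g i) xs → sumR (map f xs) ≤ sumR (map g xs)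
    sumR-mono f g []       []         = ≤-refl
    sumR-mono f g (i ∷ xs) (fi≤gi ∷ ps) = +-mono₂-≤ fi≤gi (sumR-mono f g xs ps)

    sumR-cong : (f g : A → R) (xs : List A) → All (λ i → f i ≡ g i) xs → sumR (map f xs) ≡ sumR (map g xs)
    sumR-cong f g []       []             = refl
    sumR-cong f g (i ∷ xs) (fi≡gi ∷ eqs) = cong₂ _+_ fi≡gi (sumR-cong f g xs eqs)

    sumR-+ : (f g : A → R) (xs : List A) → sumR (map (λ i → f i + g i) xs) ≡ sumR (map f xs) + sumR (map g xs)
    sumR-+ f g []       = sym (+-identityʳ 0#)
    sumR-+ f g (i ∷ xs) = trans (cong (f i + g i +_) (sumR-+ f g xs)) (+-interchange (f i) (g i) _ _)

    sumR-nonneg : (f : A → R) (xs : List A) → All (λ i → 0# ≤ f i) xs → 0# ≤ sumR (map f xs)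
    sumR-nonneg f []       []            = ≤-refl
    sumR-nonneg f (i ∷ xs) (0≤fi ∷ ps) = +-nonneg 0≤fi (sumR-nonneg f xs ps)

    sumR-nonpos : (f : A → R) (xs : List A) → All (λ i → f i ≤ 0#) xs → sumR (map f xs) ≤ 0#
    sumR-nonpos f []       []            = ≤-refl
    sumR-nonpos f (i ∷ xs) (fi≤0 ∷ ps) = subst (f i + sumR (map f xs) ≤_) (+-identityʳ 0#) (+-mono₂-≤ fi≤0 (sumR-nonpos f xs ps))

-- The network notions live inside Reals ℝ, hence the otherwise unused parameter ℝ.
module CircuitPaths (ℝ : RealNumbers) {n m : ℕ} (ends : Fin m → Fin n × Fin n) (O D : Fin n) where
  open Reals ℝ using (module Network)
  open Network ends O D

  Incident : Fin n → Fin m → Set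
  Incident u e = proj₁ (ends e) ≡ u ⊎ proj₂ (ends e) ≡ u

  joins-incidentˡ : ∀ {e u w} → Joins e u w → Incident u e
  joins-incidentˡ (inj₁ refl) = inj₁ refl
  joins-incidentˡ (inj₂ refl) = inj₂ refl

  joins-incidentʳ : ∀ {e u w} → Joins e u w → Incident w e
  joins-incidentʳ (inj₁ refl) = inj₂ refl
  joins-incidentʳ (inj₂ refl) = inj₁ refl

  incident-joins : ∀ {e u w z} → Joins e u w → Incident z e → z ≡ u ⊎ z ≡ w
  incident-joins (inj₁ refl) (inj₁ refl) = inj₁ refl
  incident-joins (inj₁ refl) (inj₂ refl) = inj₂ refl
  incident-joins (inj₂ refl) (inj₁ refl) = inj₂ refl
  incident-joins (inj₂ refl) (inj₂ refl) = inj₁ refl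

  joins-functional : ∀ {e u w w'} → Joins e u w → Joins e u w' → w ≡ w'
  joins-functional (inj₁ refl) (inj₁ eq) = cong proj₂ eq
  joins-functional (inj₁ refl) (inj₂ eq) = trans (cong proj₂ eq) (cong proj₁ eq)
  joins-functional (inj₂ refl) (inj₁ eq) = trans (cong proj₁ eq) (cong proj₂ eq)
  joins-functional (inj₂ refl) (inj₂ eq) = cong proj₁ eq

  trail-start∈ : ∀ {u w es vs} → Trail u w es vs → u ∈ₗ vs
  trail-start∈ nil        = here refl
  trail-start∈ (cons _ _) = here refl

  trail-end∈ : ∀ {u w es vs} → Trail u w es vs → w ∈ₗ vs
  trail-end∈ nil          = here refl
  trail-end∈ (cons _ τ)   = there (trail-end∈ τ)

  trail-incident∈ : ∀ {u w es vs e z} → Trail u w es vs → e ∈ₗ es → Incident z e → z ∈ₗ vs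
  trail-incident∈ (cons j τ) (here refl) z∼e with incident-joins j z∼e
  ... | inj₁ refl = here refl
  ... | inj₂ refl = there (trail-start∈ τ)
  trail-incident∈ (cons j τ) (there e∈es) z∼e = there (trail-incident∈ τ e∈es z∼e)

  simple-loop-empty : ∀ {u es vs} → Trail u u es vs → Unique vs → es ≡ []
  simple-loop-empty nil        _          = refl
  simple-loop-empty (cons j τ) (u∉ ∷ _) = ⊥-elim (All¬⇒¬Any u∉ (trail-end∈ τ))

  start-edge-unique : ∀ {u w es vs e₁ e₂} → Trail u w es vs → Unique vs →
                      e₁ ∈ₗ es → e₂ ∈ₗ es → Incident u e₁ → Incident u e₂ → e₁ ≡ e₂
  start-edge-unique (cons j τ) _        (here refl) (here refl) _ _   = refl
  start-edge-unique (cons j τ) (u∉ ∷ _) (here refl) (there e₂∈) _ u∼e₂ = ⊥-elim (All¬⇒¬Any u∉ (trail-incident∈ τ e₂∈ u∼e₂))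
  start-edge-unique (cons j τ) (u∉ ∷ _) (there e₁∈) _ u∼e₁ _ = ⊥-elim (All¬⇒¬Any u∉ (trail-incident∈ τ e₁∈ u∼e₁))

  first-edge-avoids-end : ∀ {e u v w es vs e'} → Joins e u v → Trail v w es vs → Unique (u ∷ vs) →
                          Incident w e → e' ∈ₗ es → ⊥
  first-edge-avoids-end j τ (u∉ ∷ vs-unique) w∼e e'∈es with incident-joins j w∼e
  ... | inj₁ refl = All¬⇒¬Any u∉ (trail-end∈ τ)
  ... | inj₂ refl with simple-loop-empty τ vs-unique
  first-edge-avoids-end j τ _ _ () | inj₂ refl | refl

  end-edge-unique : ∀ {u w es vs e₁ e₂} → Trail u w es vs → Unique vs →
                    e₁ ∈ₗ es → e₂ ∈ₗ es → Incident w e₁ → Incident w e₂ → e₁ ≡ e₂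
  end-edge-unique (cons j τ) _  (here refl) (here refl) _    _    = refl
  end-edge-unique (cons j τ) us (here refl) (there e₂∈) w∼e₁ _    = ⊥-elim (first-edge-avoids-end j τ us w∼e₁ e₂∈)
  end-edge-unique (cons j τ) us (there e₁∈) (here refl) _    w∼e₂ = ⊥-elim (first-edge-avoids-end j τ us w∼e₂ e₁∈)
  end-edge-unique (cons j τ) (_ ∷ us) (there e₁∈) (there e₂∈) w∼e₁ w∼e₂ = end-edge-unique τ us e₁∈ e₂∈ w∼e₁ w∼e₂

  Repeats : Fin m → Fin m → Fin m → Set
  Repeats e₁ e₂ e₃ = e₁ ≡ e₂ ⊎ e₁ ≡ e₃ ⊎ e₂ ≡ e₃

  MaxDegree₂ : (Fin m → Set) → Set
  MaxDegree₂ F = ∀ {u e₁ e₂ e₃} → F e₁ → F e₂ → F e₃ →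
                 Incident u e₁ → Incident u e₂ → Incident u e₃ → Repeats e₁ e₂ e₃

  maxDegree₂-∷ : ∀ {e es} → MaxDegree₂ (_∈ₗ es) →
                 (∀ {u e₁ e₂} → Incident u e → e₁ ∈ₗ es → e₂ ∈ₗ es → Incident u e₁ → Incident u e₂ → e₁ ≡ e₂) →
                 MaxDegree₂ (_∈ₗ e ∷ es)
  maxDegree₂-∷ deg one (here refl) (here refl) _           _ _ _ = inj₁ refl
  maxDegree₂-∷ deg one (here refl) (there _)   (here refl) _ _ _ = inj₂ (inj₁ refl)
  maxDegree₂-∷ deg one (here refl) (there e₂∈) (there e₃∈) u∼e u∼e₂ u∼e₃ = inj₂ (inj₂ (one u∼e e₂∈ e₃∈ u∼e₂ u∼e₃))
  maxDegree₂-∷ deg one (there _)   (here refl) (here refl) _ _ _ = inj₂ (inj₂ refl)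
  maxDegree₂-∷ deg one (there e₁∈) (here refl) (there e₃∈) u∼e₁ u∼e u∼e₃ = inj₂ (inj₁ (one u∼e e₁∈ e₃∈ u∼e₁ u∼e₃))
  maxDegree₂-∷ deg one (there e₁∈) (there e₂∈) (here refl) u∼e₁ u∼e₂ u∼e = inj₁ (one u∼e e₁∈ e₂∈ u∼e₁ u∼e₂)
  maxDegree₂-∷ deg one (there e₁∈) (there e₂∈) (there e₃∈) = deg e₁∈ e₂∈ e₃∈

  simple-trail-maxDegree₂ : ∀ {u w es vs} → Trail u w es vs → Unique vs → MaxDegree₂ (_∈ₗ es)
  simple-trail-maxDegree₂ nil        _ ()
  simple-trail-maxDegree₂ (cons j τ) (u∉ ∷ us) = maxDegree₂-∷ (simple-trail-maxDegree₂ τ us) one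
    where
    one : ∀ {z e₁ e₂} → Incident z _ → e₁ ∈ₗ _ → e₂ ∈ₗ _ → Incident z e₁ → Incident z e₂ → e₁ ≡ e₂
    one z∼e e₁∈ e₂∈ z∼e₁ z∼e₂ with incident-joins j z∼e
    ... | inj₁ refl = ⊥-elim (All¬⇒¬Any u∉ (trail-incident∈ τ e₁∈ z∼e₁))
    ... | inj₂ refl = start-edge-unique τ us e₁∈ e₂∈ z∼e₁ z∼e₂

  simple-cycle-maxDegree₂ : ∀ {v es vs} → es ≢ [] → Trail v v es (v ∷ vs) → Unique vs → MaxDegree₂ (_∈ₗ es)
  simple-cycle-maxDegree₂ es≢[] nil        _  = ⊥-elim (es≢[] refl)
  simple-cycle-maxDegree₂ _     (cons j τ) us = maxDegree₂-∷ (simple-trail-maxDegree₂ τ us) one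
    where
    one : ∀ {z e₁ e₂} → Incident z _ → e₁ ∈ₗ _ → e₂ ∈ₗ _ → Incident z e₁ → Incident z e₂ → e₁ ≡ e₂
    one z∼e e₁∈ e₂∈ z∼e₁ z∼e₂ with incident-joins j z∼e
    ... | inj₁ refl = end-edge-unique τ us e₁∈ e₂∈ z∼e₁ z∼e₂
    ... | inj₂ refl = start-edge-unique τ us e₁∈ e₂∈ z∼e₁ z∼e₂

  first-edge-∉-tail : ∀ {e u v w es vs} → Joins e u v → Trail v w es vs → Unique (u ∷ vs) → e ∉ₗ es
  first-edge-∉-tail j τ (u∉ ∷ _) e∈es = All¬⇒¬Any u∉ (trail-incident∈ τ e∈es (joins-incidentˡ j))

  module _ {F : Fin m → Set} (deg : MaxDegree₂ F) where

    -- f is an F-edge at u used by neither trail (the edge we arrived by); as u has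
    -- F-degree at most two, both trails leave u by the same edge.
    simple-trails-agree : ∀ {u w es₁ es₂ vs₁ vs₂ f} →
      Trail u w es₁ vs₁ → Trail u w es₂ vs₂ → Unique vs₁ → Unique vs₂ → All F es₁ → All F es₂ →
      F f → Incident u f → f ∉ₗ es₁ → f ∉ₗ es₂ → es₁ ≡ es₂

    same-first-edge : ∀ {u w e₁ e₂ es₁ es₂ vs₁ vs₂} → e₁ ≡ e₂ →
      Trail u w (e₁ ∷ es₁) vs₁ → Trail u w (e₂ ∷ es₂) vs₂ → Unique vs₁ → Unique vs₂ →
      All F (e₁ ∷ es₁) → All F (e₂ ∷ es₂) → e₁ ∷ es₁ ≡ e₂ ∷ es₂

    simple-trails-agree nil nil _ _ _ _ _ _ _ _ = refl
    simple-trails-agree nil τ₂@(cons _ _) _ us₂ _ _ _ _ _ _ = sym (simple-loop-empty τ₂ us₂)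
    simple-trails-agree τ₁@(cons _ _) nil us₁ _ _ _ _ _ _ _ = simple-loop-empty τ₁ us₁
    simple-trails-agree τ₁@(cons j₁ _) τ₂@(cons j₂ _) us₁ us₂ F₁@(Fe₁ ∷ _) F₂@(Fe₂ ∷ _) Ff u∼f f∉₁ f∉₂
      with deg Ff Fe₁ Fe₂ u∼f (joins-incidentˡ j₁) (joins-incidentˡ j₂)
    ... | inj₁ refl        = ⊥-elim (f∉₁ (here refl))
    ... | inj₂ (inj₁ refl) = ⊥-elim (f∉₂ (here refl))
    ... | inj₂ (inj₂ e₁≡e₂) = same-first-edge e₁≡e₂ τ₁ τ₂ us₁ us₂ F₁ F₂

    same-first-edge refl (cons j₁ τ₁) (cons j₂ τ₂) us₁@(_ ∷ us₁') us₂@(_ ∷ us₂') (Fe ∷ F₁) (_ ∷ F₂)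
      with joins-functional j₁ j₂
    ... | refl = cong (_ ∷_) (simple-trails-agree τ₁ τ₂ us₁' us₂' F₁ F₂ Fe (joins-incidentʳ j₁)
                                (first-edge-∉-tail j₁ τ₁ us₁) (first-edge-∉-tail j₂ τ₂ us₂))

    three-simple-trails : ∀ {u w es₁ es₂ es₃ vs₁ vs₂ vs₃} →
      Trail u w es₁ vs₁ → Trail u w es₂ vs₂ → Trail u w es₃ vs₃ → Unique vs₁ → Unique vs₂ → Unique vs₃ →
      All F es₁ → All F es₂ → All F es₃ → es₁ ≡ es₂ ⊎ es₁ ≡ es₃ ⊎ es₂ ≡ es₃
    three-simple-trails nil τ₂ _ _ us₂ _ _ _ _ = inj₁ (sym (simple-loop-empty τ₂ us₂))
    three-simple-trails τ₁@(cons _ _) nil _ us₁ _ _ _ _ _ = inj₁ (simple-loop-empty τ₁ us₁)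
    three-simple-trails τ₁@(cons _ _) (cons _ _) nil us₁ _ _ _ _ _ = inj₂ (inj₁ (simple-loop-empty τ₁ us₁))
    three-simple-trails τ₁@(cons j₁ _) τ₂@(cons j₂ _) τ₃@(cons j₃ _) us₁ us₂ us₃ F₁@(Fe₁ ∷ _) F₂@(Fe₂ ∷ _) F₃@(Fe₃ ∷ _)
      with deg Fe₁ Fe₂ Fe₃ (joins-incidentˡ j₁) (joins-incidentˡ j₂) (joins-incidentˡ j₃)
    ... | inj₁ eq        = inj₁ (same-first-edge eq τ₁ τ₂ us₁ us₂ F₁ F₂)
    ... | inj₂ (inj₁ eq) = inj₂ (inj₁ (same-first-edge eq τ₁ τ₃ us₁ us₃ F₁ F₃))
    ... | inj₂ (inj₂ eq) = inj₂ (inj₂ (same-first-edge eq τ₂ τ₃ us₂ us₃ F₂ F₃))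

  circuit-maxDegree₂ : IsCircuit → MaxDegree₂ Relevant
  circuit-maxDegree₂ (_ , _ , _ , cyc≢[] , cycle , us , _ , relevant⊆cyc , _) r₁ r₂ r₃ =
    simple-cycle-maxDegree₂ cyc≢[] cycle us (relevant⊆cyc _ r₁) (relevant⊆cyc _ r₂) (relevant⊆cyc _ r₃)

  simplePath-relevant : ∀ {s} → SimplePath s → All Relevant s
  simplePath-relevant {s} sp = tabulate λ e∈s → s , sp , e∈s

  circuit-two-simplePaths : IsCircuit → ∀ {P Q s} → P ≢ Q → SimplePath P → SimplePath Q → SimplePath s →
                            s ≡ P ⊎ s ≡ Q
  circuit-two-simplePaths circuit P≢Q spP@(_ , τP , uP) spQ@(_ , τQ , uQ) sp@(_ , τ , u)
    with three-simple-trails (circuit-maxDegree₂ circuit) τP τQ τ uP uQ u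
           (simplePath-relevant spP) (simplePath-relevant spQ) (simplePath-relevant sp)
  ... | inj₁ P≡Q        = ⊥-elim (P≢Q P≡Q)
  ... | inj₂ (inj₁ P≡s) = inj₁ (sym P≡s)
  ... | inj₂ (inj₂ Q≡s) = inj₂ (sym Q≡s)

module RouteFlows (ℝ : RealNumbers) {n m : ℕ} (ends : Fin m → Fin n × Fin n) (O D : Fin n)
                  (t : ℕ) (c : Fin m → Reals.R ℝ → Reals.R∞ ℝ) (d : Fin (suc t) → Reals.R ℝ) where
  open Reals ℝ
  open Network ends O D
  open Game t c d
  open IsCommutativeRing isCommutativeRing using (+-identityˡ; +-identityʳ)
  open OrderedFieldProperties ℝ
  open ListSums ℝ

  Route : Set
  Route = List (Fin m)

  weight : (Route → Bool) → Route × R → R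
  weight g p = if g (proj₁ p) then proj₂ p else 0#

  mass : (Route → Bool) → List (Route × R) → R
  mass g xs = sumR (map (weight g) xs)

  flow : List (Route × R) → R
  flow xs = sumR (map proj₂ xs)

  -- load y e unfolds to overall (weight (occurs e)) y.
  overall : (Route × R → R) → Outcome → R
  overall f y = sumR (map (λ k → sumR (map f (y k))) (allFin (suc t)))

  isRoute : Route → Route → Bool
  isRoute A s = does (≡-dec _≟_ s A)

  routeFlow : Route → Outcome → R
  routeFlow A = overall (weight (isRoute A))

  isRoute-refl : ∀ A → isRoute A A ≡ true
  isRoute-refl A = dec-true (≡-dec _≟_ A A) refl

  isRoute-≢ : ∀ {A s} → s ≢ A → isRoute A s ≡ false
  isRoute-≢ {A} {s} s≢A = dec-false (≡-dec _≟_ s A) s≢A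

  isRoute-true : ∀ {A s} → isRoute A s ≡ true → s ≡ A
  isRoute-true {A} {s} with ≡-dec _≟_ s A
  ... | yes s≡A = λ _ → s≡A
  ... | no  _   = λ ()

  isRoute-false : ∀ {A s} → isRoute A s ≡ false → s ≢ A
  isRoute-false {A} isA≡false refl with () ← trans (sym (isRoute-refl A)) isA≡false

  occurs-∈ : ∀ {e s} → e ∈ₗ s → occurs e s ≡ true
  occurs-∈ {e} {_ ∷ s} (here refl) = cong (λ b → if b then true else occurs e s) (dec-true (e ≟ e) refl)
  occurs-∈ {e} {e' ∷ s} (there e∈s) with does (e ≟ e')
  ... | true  = refl
  ... | false = occurs-∈ e∈s

  weight-≤ : ∀ g p → 0# ≤ proj₂ p → weight g p ≤ proj₂ p
  weight-≤ g p 0≤a with g (proj₁ p)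
  ... | true  = ≤-refl
  ... | false = 0≤a

  weight-nonneg : ∀ g p → 0# ≤ proj₂ p → 0# ≤ weight g p
  weight-nonneg g p 0≤a with g (proj₁ p)
  ... | true  = 0≤a
  ... | false = ≤-refl

  NonnegFlows : List (Route × R) → Set
  NonnegFlows = All (λ p → 0# ≤ proj₂ p)

  mass-≤-flow : ∀ g xs → NonnegFlows xs → mass g xs ≤ flow xs
  mass-≤-flow g xs nonneg = sumR-mono _ _ xs (All.map (λ {p} → weight-≤ g p) nonneg)

  mass-nonneg : ∀ g xs → NonnegFlows xs → 0# ≤ mass g xs
  mass-nonneg g xs nonneg = sumR-nonneg _ xs (All.map (λ {p} → weight-nonneg g p) nonneg)

  mass-≤0 : ∀ A xs → All (λ p → proj₁ p ≡ A → proj₂ p ≤ 0#) xs → mass (isRoute A) xs ≤ 0#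
  mass-≤0 A xs on-A≤0 = sumR-nonpos _ xs (All.map (λ {p} → weight≤0 p) on-A≤0)
    where
    weight≤0 : ∀ p → (proj₁ p ≡ A → proj₂ p ≤ 0#) → weight (isRoute A) p ≤ 0#
    weight≤0 p h with isRoute A (proj₁ p) in eq
    ... | true  = h (isRoute-true eq)
    ... | false = ≤-refl

  flow-≤-mass : ∀ A xs → All (λ p → proj₁ p ≢ A → proj₂ p ≤ 0#) xs → flow xs ≤ mass (isRoute A) xs
  flow-≤-mass A xs off-A≤0 = sumR-mono _ _ xs (All.map (λ {p} → ≤weight p) off-A≤0)
    where
    ≤weight : ∀ p → (proj₁ p ≢ A → proj₂ p ≤ 0#) → proj₂ p ≤ weight (isRoute A) p
    ≤weight p h with isRoute A (proj₁ p) in eq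
    ... | true  = ≤-refl
    ... | false = h (isRoute-false eq)

  overall-cong : ∀ f g y → (∀ k → All (λ p → f p ≡ g p) (y k)) → overall f y ≡ overall g y
  overall-cong f g y f≗g = sumR-cong _ _ (allFin (suc t)) (All.universal (λ k → sumR-cong f g (y k) (f≗g k)) _)

  overall-+ : ∀ f g y → overall (λ p → f p + g p) y ≡ overall f y + overall g y
  overall-+ f g y = trans (sumR-cong _ _ (allFin (suc t)) (All.universal (λ k → sumR-+ f g (y k)) _))
                          (sumR-+ _ _ (allFin (suc t)))

  module _ {E : InfoSets} {y : Outcome} (feasible : Feasible E y) where

    feasible-nonneg : ∀ k → NonnegFlows (y k)
    feasible-nonneg k = All.map proj₂ (proj₁ (feasible k))

    feasible-strategy : ∀ {k s a} → (s , a) ∈ₗ y k → Strategy E k s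
    feasible-strategy {k} mem = proj₁ (All.lookup (proj₁ (feasible k)) mem)

    overall-flow : overall proj₂ y ≡ sumR (map d (allFin (suc t)))
    overall-flow = sumR-cong _ _ (allFin (suc t)) (All.universal (λ k → proj₂ (feasible k)) _)

    load-nonneg : ∀ e → 0# ≤ load y e
    load-nonneg e = sumR-nonneg _ (allFin (suc t))
      (All.universal (λ k → mass-nonneg (occurs e) (y k) (feasible-nonneg k)) _)

  Uses : Outcome → Fin (suc t) → Route → Set
  Uses y k s = ∃[ a ] ((s , a) ∈ₗ y k × 0# < a)

  unused-flow≤0 : ∀ {E y k s} → Feasible E y → ¬ Uses y k s → All (λ p → proj₁ p ≡ s → proj₂ p ≤ 0#) (y k)
  unused-flow≤0 {k = k} feasible ¬uses = tabulate λ { {_ , a} mem refl →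
    ¬positive⇒≤0 (All.lookup (feasible-nonneg feasible k) mem) (λ 0<a → ¬uses (a , mem , 0<a)) }

  used-cheapest : ∀ {E y k s s'} → ICUE E y → Uses y k s → Strategy E k s' → pathCost y s ≤∞ pathCost y s'
  used-cheapest (_ , equilibrium) (a , mem , 0<a) = equilibrium _ _ a mem 0<a _

  pathCost-mono : (∀ e → AdmissibleCost (c e)) → ∀ {y y'} → (∀ e → 0# ≤ load y e) →
                  ∀ s → (∀ {e} → e ∈ₗ s → load y e ≤ load y' e) → pathCost y s ≤∞ pathCost y' s
  pathCost-mono admissible nonneg []      _      = ≤-refl
  pathCost-mono admissible {y} {y'} nonneg (e ∷ s) load≤ =
    +∞-mono-≤∞ {c e (load y e)} {c e (load y' e)} {pathCost y s} {pathCost y' s}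
      (proj₁ (proj₂ (admissible e)) _ _ (nonneg e) (load≤ (here refl)))
      (pathCost-mono admissible {y} {y'} nonneg s (load≤ ∘ there))

  OnRoutes : Route → Route → Outcome → Set
  OnRoutes A B y = ∀ k → All (λ p → proj₁ p ≡ A ⊎ proj₁ p ≡ B) (y k)

  onRoutes-swap : ∀ {A B y} → OnRoutes A B y → OnRoutes B A y
  onRoutes-swap on k = All.map Sum.swap (on k)

  module _ {A B : Route} (A≢B : A ≢ B) where

    routeFlow-+ : ∀ {y} → OnRoutes A B y → routeFlow A y + routeFlow B y ≡ overall proj₂ y
    routeFlow-+ {y} on = trans (sym (overall-+ _ _ y)) (overall-cong _ _ y λ k → All.map split (on k))
      where
      split : ∀ {p} → proj₁ p ≡ A ⊎ proj₁ p ≡ B → weight (isRoute A) p + weight (isRoute B) p ≡ proj₂ p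
      split {_ , a} (inj₁ refl) rewrite isRoute-refl A | isRoute-≢ A≢B = +-identityʳ a
      split {_ , a} (inj₂ refl) rewrite isRoute-refl B | isRoute-≢ (A≢B ∘ sym) = +-identityˡ a

    load-≤-along : ∀ {y y'} → OnRoutes A B y → OnRoutes A B y' → overall proj₂ y ≡ overall proj₂ y' →
                   routeFlow A y ≤ routeFlow A y' → ∀ {e} → e ∈ₗ A → load y e ≤ load y' e
    load-≤-along {y} {y'} on on' total≡ A-flow≤ {e} e∈A with occurs e B in e∈?B
    ... | true  = ≤-reflexive (trans (overall-cong _ _ y (λ k → All.map shared (on k)))
                                (trans total≡ (sym (overall-cong _ _ y' (λ k → All.map shared (on' k))))))
      where
      shared : ∀ {p} → proj₁ p ≡ A ⊎ proj₁ p ≡ B → weight (occurs e) p ≡ proj₂ p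
      shared (inj₁ refl) rewrite occurs-∈ e∈A = refl
      shared (inj₂ refl) rewrite e∈?B = refl
    ... | false = subst₂ _≤_ (sym (overall-cong _ _ y (λ k → All.map unshared (on k))))
                             (sym (overall-cong _ _ y' (λ k → All.map unshared (on' k)))) A-flow≤
      where
      unshared : ∀ {p} → proj₁ p ≡ A ⊎ proj₁ p ≡ B → weight (occurs e) p ≡ weight (isRoute A) p
      unshared (inj₁ refl) rewrite occurs-∈ e∈A | isRoute-refl A = refl
      unshared (inj₂ refl) rewrite e∈?B | isRoute-≢ (A≢B ∘ sym) = refl

  module InformationExpansion
    (admissible : ∀ e → AdmissibleCost (c e)) (E : InfoSets) (Ẽ₁ : Subset m)
    {P Q : Route} (P≢Q : P ≢ Q) (routes : ∀ {s} → SimplePath s → s ≡ P ⊎ s ≡ Q)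
    (Q∉S₁ : ¬ All (_∈ E zero) Q)
    {x x̃ : Outcome} (icue : ICUE E x) (icũe : ICUE (expand E Ẽ₁) x̃) where

    feasible : Feasible E x
    feasible = proj₁ icue

    feasible~ : Feasible (expand E Ẽ₁) x̃
    feasible~ = proj₁ icũe

    onRoutes : ∀ {E' y} → Feasible E' y → OnRoutes P Q y
    onRoutes feasible' k = All.map (λ h → routes (proj₁ (proj₁ h))) (proj₁ (feasible' k))

    total≡ : overall proj₂ x̃ ≡ overall proj₂ x
    total≡ = trans (overall-flow feasible~) (sym (overall-flow feasible))

    P-cost-mono : routeFlow P x̃ ≤ routeFlow P x → pathCost x̃ P ≤∞ pathCost x P
    P-cost-mono P-flow≤ = pathCost-mono admissible {x̃} {x} (load-nonneg feasible~) P
      (load-≤-along P≢Q (onRoutes feasible~) (onRoutes feasible) total≡ P-flow≤)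

    Q-cost-mono : routeFlow P x ≤ routeFlow P x̃ → pathCost x̃ Q ≤∞ pathCost x Q
    Q-cost-mono P-flow≥ = pathCost-mono admissible {x̃} {x} (load-nonneg feasible~) Q
      (load-≤-along (P≢Q ∘ sym) (onRoutes-swap (onRoutes feasible~)) (onRoutes-swap (onRoutes feasible)) total≡
        (≤-complement P-flow≥ (routeFlow-+ P≢Q (onRoutes feasible))
                              (trans (routeFlow-+ P≢Q (onRoutes feasible~)) total≡)))

    Switch : Set
    Switch = ∃[ k ] (Uses x̃ (suc k) P × Uses x (suc k) Q)

    switch⇒P-cost≤ : routeFlow P x ≤ routeFlow P x̃ → Switch → pathCost x̃ P ≤∞ pathCost x P
    switch⇒P-cost≤ P-flow≥ (k , usesP@(_ , P∈ , _) , usesQ@(_ , Q∈ , _)) =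
      ≤∞-trans {pathCost x̃ P} (used-cheapest icũe usesP (feasible-strategy feasible Q∈))
        (≤∞-trans {pathCost x̃ Q} (Q-cost-mono P-flow≥) (used-cheapest icue usesQ (feasible-strategy feasible~ P∈)))

    P-mass≤ : ∀ k → All (λ p → proj₁ p ≡ Q → proj₂ p ≤ 0#) (x k) →
              mass (isRoute P) (x̃ k) ≤ mass (isRoute P) (x k)
    P-mass≤ k Q-flow≤0 = begin
      mass (isRoute P) (x̃ k) ≤⟨ mass-≤-flow _ _ (feasible-nonneg feasible~ k) ⟩
      flow (x̃ k)             ≡⟨ proj₂ (feasible~ k) ⟩
      d k                    ≡⟨ proj₂ (feasible k) ⟨
      flow (x k)             ≤⟨ flow-≤-mass P (x k) (All.zipWith off-P≤0 (onRoutes feasible k , Q-flow≤0)) ⟩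
      mass (isRoute P) (x k) ∎
      where
      open ≤-Reasoning
      off-P≤0 : ∀ {p} → (proj₁ p ≡ P ⊎ proj₁ p ≡ Q) × (proj₁ p ≡ Q → proj₂ p ≤ 0#) → proj₁ p ≢ P → proj₂ p ≤ 0#
      off-P≤0 (inj₁ on-P , _)        off-P = ⊥-elim (off-P on-P)
      off-P≤0 (inj₂ on-Q , on-Q⇒≤0) _     = on-Q⇒≤0 on-Q

    other-type-P-mass≤ : ¬ Switch → ∀ k → mass (isRoute P) (x̃ (suc k)) ≤ mass (isRoute P) (x (suc k))
    other-type-P-mass≤ ¬switch k = ≤-stable λ mass≰ → ¬¬-excluded-middle λ where
      (yes usesP) → mass≰ (P-mass≤ (suc k) (unused-flow≤0 feasible λ usesQ → ¬switch (k , usesP , usesQ)))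
      (no ¬usesP) → mass≰ (≤-trans (mass-≤0 P _ (unused-flow≤0 feasible~ ¬usesP))
                                   (mass-nonneg _ _ (feasible-nonneg feasible (suc k))))

    no-switch⇒P-flow≤ : ¬ Switch → routeFlow P x̃ ≤ routeFlow P x
    no-switch⇒P-flow≤ ¬switch = sumR-mono _ _ (allFin (suc t)) (All.universal P-mass≤′ _)
      where
      P-mass≤′ : ∀ k → mass (isRoute P) (x̃ k) ≤ mass (isRoute P) (x k)
      P-mass≤′ zero    = P-mass≤ zero (tabulate λ { {_ , _} Q∈ refl → ⊥-elim (Q∉S₁ (proj₂ (feasible-strategy feasible Q∈))) })
      P-mass≤′ (suc k) = other-type-P-mass≤ ¬switch k

    P-cost-nonincreasing : pathCost x̃ P ≤∞ pathCost x P
    P-cost-nonincreasing = ≤∞-stable {pathCost x̃ P} λ cost≰ → case total (routeFlow P x̃) (routeFlow P x) of λ where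
      (inj₁ P-flow≤) → cost≰ (P-cost-mono P-flow≤)
      (inj₂ P-flow≥) → ¬¬-excluded-middle λ where
        (yes switch) → cost≰ (switch⇒P-cost≤ P-flow≥ switch)
        (no ¬switch) → cost≰ (P-cost-mono (no-switch⇒P-flow≤ ¬switch))

proposition2 : (ℝ : RealNumbers) → let open Reals ℝ in
    {n m : ℕ} (ends : Fin m → Fin n × Fin n) (O D : Fin n) →
    let open Network ends O D in
    IsCircuit →
    (t : ℕ) (c : Fin m → R → R∞) (d : Fin (suc t) → R) →
    let open Game t c d in
    (∀ e → AdmissibleCost (c e)) →
    (∀ k → 0# ≤ d k) →
    (E : InfoSets) →
    (∀ k e → e ∈ E k → Relevant e) →
    (∀ k → ∃[ s ] Strategy E k s) →
    (Ẽ₁ : Subset m) → E zero ⊂ Ẽ₁ → (∀ e → e ∈ Ẽ₁ → Relevant e) →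
    (x x̃ : Outcome) → ICUE E x → ICUE (expand E Ẽ₁) x̃ →
    (κ κ̃ : R∞) → IsEqCost E zero x κ → IsEqCost (expand E Ẽ₁) zero x̃ κ̃ →
    κ̃ ≤∞ κ
proposition2 ℝ ends O D circuit t c d admissible _ E _ _ Ẽ₁ (E₁⊆Ẽ₁ , e , e∈Ẽ₁ , e∉E₁) Ẽ₁-relevant x x̃ icue icũe
             κ κ̃ ((P , (P-simple , P⊆E₁) , refl) , _) (_ , κ̃-minimal) =
  ≤∞-trans {κ̃} (κ̃-minimal P (P-simple , All.map E₁⊆Ẽ₁ P⊆E₁))
    (P-cost-nonincreasing admissible E Ẽ₁ P≢Q (circuit-two-simplePaths circuit P≢Q P-simple Q-simple) Q∉S₁ icue icũe)
  where
  open Reals ℝ using (module Network)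
  open Network ends O D using (SimplePath)
  open OrderedFieldProperties ℝ using (≤∞-trans)
  open CircuitPaths ℝ ends O D using (circuit-two-simplePaths)
  open RouteFlows ℝ ends O D t c d using (Route; module InformationExpansion)
  open InformationExpansion using (P-cost-nonincreasing)

  Q : Route
  Q = proj₁ (Ẽ₁-relevant e e∈Ẽ₁)

  Q-simple : SimplePath Q
  Q-simple = proj₁ (proj₂ (Ẽ₁-relevant e e∈Ẽ₁))

  Q∉S₁ : ¬ All (_∈ E zero) Q
  Q∉S₁ Q⊆E₁ = e∉E₁ (All.lookup Q⊆E₁ (proj₂ (proj₂ (Ẽ₁-relevant e e∈Ẽ₁))))

  P≢Q : P ≢ Q
  P≢Q refl = Q∉S₁ P⊆E₁
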